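{- Let $H$ be a hypergraph. Then every power domination zero forcing set of $H$ is an infection set of $H$, and $\mathrm{I}(H)\le \mathrm{Z}_{pd}(H)$.
   Context: A hypergraph $H$ has vertex set $V(H)$ and a set $E(H)$ of edges, each a subset of $V(H)$. A vertex $w$ is a neighbor of $v$ if some edge contains both $v$ and $w$. Infection: initially the vertices of $B\subseteq V(H)$ are infected and all others uninfected. Infection rule: a nonempty set $S$ of infected vertices can infect all the other vertices of an edge $e$ if (1) $S\subset e$, and (2) for every uninfected vertex $u\notin e$, there is no edge $e'$ with $S\cup\{u\}\subseteq e'$. $B$ is an infection set if repeated application infects every vertex; $\mathrm{I}(H)$ is the minimum cardinality of an infection set. Power domination zero forcing: initially the vertices of $B$ are blue and the others white. Power domination color change rule: if all the white neighbors of a blue vertex $v$ lie in one edge that contains $v$, then all these white neighbors of $v$ become blue. $B$ is a power domination zero forcing set if repeated application colors every vertex blue; $\mathrm{Z}_{pd}(H)$ is the minimum cardinality of such a set. -}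

module Defs where

open import Data.Nat using (ℕ; _≤_)
open import Data.Fin using (Fin)
open import Data.Fin.Subset using (Subset; _∈_; _∉_; _⊆_; _∪_; ⊤; ∣_∣; Nonempty)
open import Data.Fin.Subset.Properties using (_∈?_)
open import Data.Fin.Properties using (any?)
open import Data.Vec using (tabulate)
open import Data.Product using (Σ; ∃; _×_)
open import Relation.Nullary using (¬_; does)
open import Relation.Nullary.Decidable using (_×-dec_)
open import Relation.Binary.Construct.Closure.ReflexiveTransitive using (Star)

record Hypergraph : Set where
  field
    n    : ℕ
    m    : ℕ
    edge : Fin m → Subset n

module _ (H : Hypergraph) where
  open Hypergraph H

  Neighbor : Fin n → Fin n → Set
  Neighbor v w = ∃ λ j → v ∈ edge j × w ∈ edge j

  nbrs : Fin n → Subset n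
  nbrs v = tabulate λ w → does (any? λ j → (v ∈? edge j) ×-dec (w ∈? edge j))

  data InfStep (A : Subset n) : Subset n → Set where
    infect : (S : Subset n) (j : Fin m) →
             Nonempty S → S ⊆ A → S ⊆ edge j →
             (∀ u → u ∉ A → u ∉ edge j →
                ¬ (∃ λ j' → S ⊆ edge j' × u ∈ edge j')) →
             InfStep A (A ∪ edge j)

  IsInfectionSet : Subset n → Set
  IsInfectionSet B = Star InfStep B ⊤

  data PDStep (A : Subset n) : Subset n → Set where
    force : (v : Fin n) (j : Fin m) → v ∈ A → v ∈ edge j →
            (∀ w → w ∉ A → Neighbor v w → w ∈ edge j) →
            PDStep A (A ∪ nbrs v)

  IsPDZeroForcingSet : Subset n → Set
  IsPDZeroForcingSet B = Star PDStep B ⊤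

  IsMinCard : (Subset n → Set) → ℕ → Set
  IsMinCard P k = (∃ λ B → P B × ∣ B ∣ ≡ k) × (∀ B → P B → k ≤ ∣ B ∣)
    where open import Relation.Binary.PropositionalEquality using (_≡_)

  IsInfectionNumber : ℕ → Set
  IsInfectionNumber = IsMinCard IsInfectionSet

  IsPDZeroForcingNumber : ℕ → Set
  IsPDZeroForcingNumber = IsMinCard IsPDZeroForcingSet

-- A force from a blue vertex v whose white neighbours all lie in an edge e ∋ v
-- is exactly an infection by S = {v} through e: condition (2) of the infection
-- rule fails only for an uninfected u ∉ e sharing an edge with v, i.e. a white
-- neighbour of v outside e.  Both rules produce the same set, since every
-- vertex of e is a neighbour of v and every white neighbour of v lies in e.
module Submission where

open import Defs
open import Data.Nat using (_≤_)
open import Data.Fin using (Fin)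
open import Data.Fin.Subset using (Subset; _∈_; _∉_; _⊆_; _∪_; ⁅_⁆)
open import Data.Fin.Subset.Properties
  using (_∈?_; ⊆-antisym; x∈p∪q⁺; x∈p∪q⁻; x∈⁅x⁆; x∈⁅y⁆⇒x≡y)
open import Data.Fin.Properties using (any?)
open import Data.Vec.Properties using (lookup∘tabulate; lookup⇒[]=; []=⇒lookup)
open import Data.Bool.Properties using (T-≡)
open import Data.Product using (∃; _×_; _,_)
open import Data.Sum using (inj₁; inj₂)
open import Function.Bundles using (Equivalence)
open import Relation.Nullary using (¬_; Dec; yes; no)
open import Relation.Nullary.Decidable using (_×-dec_; dec-true; isYes≗does; toWitness)
open import Relation.Binary.PropositionalEquality using (_≡_; trans; sym; subst)
open import Relation.Binary.Construct.Closure.ReflexiveTransitive using (map)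

x∈p⇒⁅x⁆⊆p : ∀ {n} {x : Fin n} {p : Subset n} → x ∈ p → ⁅ x ⁆ ⊆ p
x∈p⇒⁅x⁆⊆p {x = x} {p} x∈p y∈⁅x⁆ = subst (_∈ p) (sym (x∈⁅y⁆⇒x≡y x y∈⁅x⁆)) x∈p

IsMinCard-antitone : (H : Hypergraph) {P Q : Subset (Hypergraph.n H) → Set} →
  (∀ B → P B → Q B) → ∀ {p q} → IsMinCard H Q q → IsMinCard H P p → q ≤ p
IsMinCard-antitone H P⇒Q (_ , q-minimal) ((B , PB , ∣B∣≡p) , _) =
  subst (_ ≤_) ∣B∣≡p (q-minimal B (P⇒Q B PB))

module _ (H : Hypergraph) where
  open Hypergraph H

  Neighbor? : (v w : Fin n) → Dec (Neighbor H v w)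
  Neighbor? v w = any? λ j → (v ∈? edge j) ×-dec (w ∈? edge j)

  Neighbor⇒∈nbrs : ∀ {v w} → Neighbor H v w → w ∈ nbrs H v
  Neighbor⇒∈nbrs {v} {w} vw =
    lookup⇒[]= w _ (trans (lookup∘tabulate _ w) (dec-true (Neighbor? v w) vw))

  ∈nbrs⇒Neighbor : ∀ {v w} → w ∈ nbrs H v → Neighbor H v w
  ∈nbrs⇒Neighbor {v} {w} w∈nbrs = toWitness {a? = Neighbor? v w}
    (Equivalence.from T-≡ (trans (isYes≗does (Neighbor? v w))
      (trans (sym (lookup∘tabulate _ w)) ([]=⇒lookup w∈nbrs))))

  ∪-edge≡∪-nbrs : ∀ {A v j} → v ∈ edge j →
    (∀ w → w ∉ A → Neighbor H v w → w ∈ edge j) → A ∪ edge j ≡ A ∪ nbrs H v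
  ∪-edge≡∪-nbrs {A} {v} {j} v∈e white⊆e = ⊆-antisym edge⇒nbrs nbrs⇒edge
    where
    edge⇒nbrs : A ∪ edge j ⊆ A ∪ nbrs H v
    edge⇒nbrs {x} x∈ with x∈p∪q⁻ A (edge j) x∈
    ... | inj₁ x∈A = x∈p∪q⁺ (inj₁ x∈A)
    ... | inj₂ x∈e = x∈p∪q⁺ (inj₂ (Neighbor⇒∈nbrs (j , v∈e , x∈e)))

    nbrs⇒edge : A ∪ nbrs H v ⊆ A ∪ edge j
    nbrs⇒edge {x} x∈ with x∈p∪q⁻ A (nbrs H v) x∈ | x ∈? A
    ... | inj₁ x∈A | _      = x∈p∪q⁺ (inj₁ x∈A)
    ... | inj₂ _   | yes x∈A = x∈p∪q⁺ (inj₁ x∈A)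
    ... | inj₂ x∈N | no x∉A  = x∈p∪q⁺ (inj₂ (white⊆e x x∉A (∈nbrs⇒Neighbor x∈N)))

  PDStep⇒InfStep : ∀ {A A′} → PDStep H A A′ → InfStep H A A′
  PDStep⇒InfStep {A} (force v j v∈A v∈e white⊆e) =
    subst (InfStep H A) (∪-edge≡∪-nbrs v∈e white⊆e)
      (infect ⁅ v ⁆ j (v , x∈⁅x⁆ v) (x∈p⇒⁅x⁆⊆p v∈A) (x∈p⇒⁅x⁆⊆p v∈e) no-escape)
    where
    no-escape : ∀ u → u ∉ A → u ∉ edge j →
      ¬ (∃ λ j′ → ⁅ v ⁆ ⊆ edge j′ × u ∈ edge j′)
    no-escape u u∉A u∉e (j′ , v∈e′ , u∈e′) =
      u∉e (white⊆e u u∉A (j′ , v∈e′ (x∈⁅x⁆ v) , u∈e′))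

  PDZeroForcingSet⇒InfectionSet : ∀ B → IsPDZeroForcingSet H B → IsInfectionSet H B
  PDZeroForcingSet⇒InfectionSet _ = map PDStep⇒InfStep

theorem2p4 : (H : Hypergraph) →
    ((B : Subset (Hypergraph.n H)) → IsPDZeroForcingSet H B → IsInfectionSet H B)
    × (∀ i z → IsInfectionNumber H i → IsPDZeroForcingNumber H z → i ≤ z)
theorem2p4 H =
  PDZeroForcingSet⇒InfectionSet H ,
  λ _ _ → IsMinCard-antitone H (PDZeroForcingSet⇒InfectionSet H)
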